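{- Let $\Lambda_\oplus$ be the untyped probabilistic $\lambda$-calculus $M ::= x \mid MM \mid \lambda x.M \mid M\oplus M$ with call-by-name semantics (evaluation contexts $E::=[\cdot]\mid EM$; $M\oplus N$ reduces to $M$ or $N$ each with probability $\frac12$; $(\lambda x.M)N$ reduces to $M\{N/x\}$), and let $\sum[\![M]\!]$ denote the convergence probability of a closed term $M$. Let $\delta_{\text{cbn}}(M,N)=\sup_{\mathsf T}|\mathrm{Pr}(M,\mathsf T)-\mathrm{Pr}(N,\mathsf T)|$, where traces are $\mathsf T = N_1\cdots N_m\cdot\top$ with $N_i\in\Lambda_\oplus$ having free variables among $\{x\}$ and $\mathrm{Pr}(M,N_1\cdots N_m\cdot\top)=\sum[\![M\,(N_1\{M/x\})\cdots(N_m\{M/x\})]\!]$. Call a CIU context any context of the form $E=(\lambda x.\,x\,M_1\cdots M_n)[\cdot]$ with $M_1,\ldots,M_n\in\Lambda_\oplus$. Then for all closed $M,N\in\Lambda_\oplus$, $$\delta_{\text{cbn}}(M,N)=\sup_{E \text{ CIU context}}\left|\sum[\![E[M]]\!]-\sum[\![E[N]]\!]\right|.$$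
   Context: $\delta_{\text{cbn}}$ is the call-by-name trace distance on $\Lambda_\oplus$ (originally defined via a stable fragment of a labelled Markov chain on tuples of linear-calculus terms obtained through Girard's translation, and shown equal to the trace formula above). The proposition expresses it purely contextually; since CIU contexts are particular contexts, it immediately gives $\delta_{\text{cbn}}\le\delta_{\text{cbn}}^c$, the call-by-name context distance. -}

module Defs where

open import Data.Nat using (ℕ; zero; suc)
open import Data.Fin using (Fin; zero; suc)
open import Data.List using (List; []; _∷_; map)
open import Data.Product using (∃-syntax; _×_)
open import Data.Rational using (ℚ; 0ℚ; 1ℚ; ½; _+_; _*_; _≤_; _<_)

data Tm (n : ℕ) : Set where
  var : Fin n → Tm n
  app : Tm n → Tm n → Tm n
  lam : Tm (suc n) → Tm n
  _⊕_ : Tm n → Tm n → Tm n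

ext : ∀ {m n} → (Fin m → Fin n) → Fin (suc m) → Fin (suc n)
ext ρ zero = zero
ext ρ (suc i) = suc (ρ i)

ren : ∀ {m n} → (Fin m → Fin n) → Tm m → Tm n
ren ρ (var i) = var (ρ i)
ren ρ (app M N) = app (ren ρ M) (ren ρ N)
ren ρ (lam M) = lam (ren (ext ρ) M)
ren ρ (M ⊕ N) = ren ρ M ⊕ ren ρ N

exts : ∀ {m n} → (Fin m → Tm n) → Fin (suc m) → Tm (suc n)
exts σ zero = var zero
exts σ (suc i) = ren suc (σ i)

sub : ∀ {m n} → (Fin m → Tm n) → Tm m → Tm n
sub σ (var i) = σ i
sub σ (app M N) = app (sub σ M) (sub σ N)
sub σ (lam M) = lam (sub (exts σ) M)
sub σ (M ⊕ N) = sub σ M ⊕ sub σ N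

-- M [ N ] = M{N/x}, x the outermost bound variable (index 0)
subst0 : ∀ {n} → Tm n → Fin (suc n) → Tm n
subst0 N zero = N
subst0 N (suc i) = var i

_[_] : ∀ {n} → Tm (suc n) → Tm n → Tm n
M [ N ] = sub (subst0 N) M

apps : ∀ {n} → Tm n → List (Tm n) → Tm n
apps M [] = M
apps M (N ∷ Ns) = apps (app M N) Ns

data Step : Set where
  val    : Tm 1 → Step
  det    : Tm 0 → Step
  choice : Tm 0 → Tm 0 → Step

step : Tm 0 → Step
step (var ())
step (lam M) = val M
step (M ⊕ N) = choice M N
step (app M N) with step M
... | val B = det (B [ N ])
... | det M' = det (app M' N)
... | choice M₁ M₂ = choice (app M₁ N) (app M₂ N)

-- probability of converging (reaching a value) within k steps;
-- increasing in k, and ∑⟦M⟧ = sup_k conv k M.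
conv : ℕ → Tm 0 → ℚ
conv zero M = 0ℚ
conv (suc k) M with step M
... | val _ = 1ℚ
... | det M' = conv k M'
... | choice M₁ M₂ = ½ * (conv k M₁ + conv k M₂)

-- For increasing sequences a, b : ℕ → ℚ (denoting the reals sup a, sup b):
-- SupLe a b q  means  sup a ≤ sup b + q
SupLe : (ℕ → ℚ) → (ℕ → ℚ) → ℚ → Set
SupLe a b q = ∀ (n : ℕ) (ε : ℚ) → 0ℚ < ε → ∃[ m ] (a n ≤ (b m + q) + ε)

DistLe : (ℕ → ℚ) → (ℕ → ℚ) → ℚ → Set
DistLe a b q = SupLe a b q × SupLe b a q

Trace : Set
Trace = List (Tm 1)

-- Pr(M, N₁⋯Nₘ·⊤) = ∑⟦M (N₁{M/x}) ⋯ (Nₘ{M/x})⟧, as the sequence of its approximants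
Pr : Tm 0 → Trace → ℕ → ℚ
Pr M T k = conv k (apps M (map (λ N → N [ M ]) T))

δcbn≤ : Tm 0 → Tm 0 → ℚ → Set
δcbn≤ M N q = ∀ (T : Trace) → DistLe (Pr M T) (Pr N T) q

-- CIU context (λx. x M₁ ⋯ Mₙ)[·], given by M₁ ⋯ Mₙ with FV(Mᵢ) ⊆ {x}
CIU : Set
CIU = List (Tm 1)

plugCIU : CIU → Tm 0 → Tm 0
plugCIU Ms M = app (lam (apps (var zero) Ms)) M

δciu≤ : Tm 0 → Tm 0 → ℚ → Set
δciu≤ M N q = ∀ (E : CIU) → DistLe (λ k → conv k (plugCIU E M)) (λ k → conv k (plugCIU E N)) q

-- A CIU context (λx. x M₁ ⋯ Mₙ)[·] applied to M performs one β-step and then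
-- runs exactly the trace experiment M (M₁{M/x}) ⋯ (Mₙ{M/x}). So the two
-- families of convergence approximants agree up to a delay of one step, and
-- a delay changes no supremum.
module Submission where

open import Defs
open import Data.Nat using (ℕ; zero; suc; pred)
open import Data.Fin using (Fin)
open import Data.List using (List; []; _∷_; map)
open import Data.Product using (_,_)
open import Data.Rational using (ℚ; _+_)
open import Data.Rational.Properties using (module ≤-Reasoning)
open import Function.Bundles using (_⇔_; mk⇔; module Equivalence)
open import Relation.Binary.PropositionalEquality using (_≡_; refl; sym; cong)

sub-apps : ∀ {m n} (σ : Fin m → Tm n) (M : Tm m) (Ns : List (Tm m)) →
           sub σ (apps M Ns) ≡ apps (sub σ M) (map (sub σ) Ns)
sub-apps σ M []       = refl
sub-apps σ M (N ∷ Ns) = sub-apps σ (app M N) Ns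

conv-plugCIU : ∀ (E : CIU) (M : Tm 0) (k : ℕ) →
               conv k (plugCIU E M) ≡ Pr M E (pred k)
conv-plugCIU E M zero    = refl
conv-plugCIU E M (suc k) = cong (conv k) (sub-apps (subst0 M) (var _) E)

module _ {a b a′ b′ : ℕ → ℚ}
         (a′≡a∘pred : ∀ k → a′ k ≡ a (pred k))
         (b′≡b∘pred : ∀ k → b′ k ≡ b (pred k)) where

  open ≤-Reasoning

  SupLe-delay : ∀ {q} → SupLe a b q ⇔ SupLe a′ b′ q
  SupLe-delay {q} = mk⇔ to from
    where
    to : SupLe a b q → SupLe a′ b′ q
    to h n ε ε>0 with h (pred n) ε ε>0
    ... | m , a≤b = suc m , (begin
      a′ n            ≡⟨ a′≡a∘pred n ⟩
      a (pred n)      ≤⟨ a≤b ⟩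
      b m + q + ε     ≡⟨ cong (λ x → x + q + ε) (sym (b′≡b∘pred (suc m))) ⟩
      b′ (suc m) + q + ε ∎)

    from : SupLe a′ b′ q → SupLe a b q
    from h n ε ε>0 with h (suc n) ε ε>0
    ... | m , a′≤b′ = pred m , (begin
      a n             ≡⟨ sym (a′≡a∘pred (suc n)) ⟩
      a′ (suc n)      ≤⟨ a′≤b′ ⟩
      b′ m + q + ε    ≡⟨ cong (λ x → x + q + ε) (b′≡b∘pred m) ⟩
      b (pred m) + q + ε ∎)

DistLe-delay : ∀ {a b a′ b′ : ℕ → ℚ} {q} →
               (∀ k → a′ k ≡ a (pred k)) → (∀ k → b′ k ≡ b (pred k)) →
               DistLe a b q ⇔ DistLe a′ b′ q
DistLe-delay {a} {b} {a′} {b′} ha hb = mk⇔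
  (λ (ab , ba) → to   a≤b ab , to   b≤a ba)
  (λ (ab , ba) → from a≤b ab , from b≤a ba)
  where
  open Equivalence
  a≤b : ∀ {q} → SupLe a b q ⇔ SupLe a′ b′ q
  a≤b = SupLe-delay {a} {b} {a′} {b′} ha hb
  b≤a : ∀ {q} → SupLe b a q ⇔ SupLe b′ a′ q
  b≤a = SupLe-delay {b} {a} {b′} {a′} hb ha

proposition14 : (M N : Tm 0) → (q : ℚ) → δcbn≤ M N q ⇔ δciu≤ M N q
proposition14 M N q = mk⇔
  (λ h E → to   (DistLe-delay-CIU E) (h E))
  (λ h E → from (DistLe-delay-CIU E) (h E))
  where
  open Equivalence
  DistLe-delay-CIU : ∀ E → DistLe (Pr M E) (Pr N E) q ⇔
                     DistLe (λ k → conv k (plugCIU E M)) (λ k → conv k (plugCIU E N)) q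
  DistLe-delay-CIU E = DistLe-delay (conv-plugCIU E M) (conv-plugCIU E N)
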